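{- Let $(r \times c, v)$ be a parameter set admissible for triple arrays with $\max(r, c) < v < rc$, and suppose $r = e + 1$, where $e = \frac{rc}{v}$. Then $c = e^2$ and $v = e(e + 1)$.
   Context: A parameter set $(r \times c, v)$ of positive integers is admissible for triple arrays if $e := \frac{rc}{v}$, $\lambda_{rr} := \frac{c(e-1)}{r-1}$ and $\lambda_{cc} := \frac{r(e-1)}{c-1}$ are integers. -}

module Defs where

open import Data.Nat using (ℕ; _+_; _*_; _∸_; _≤_; _<_; _⊔_)
open import Data.Product using (Σ; _×_; ∃)
open import Relation.Binary.PropositionalEquality using (_≡_)

-- The quotients by r-1 and c-1 are only defined when
-- r ≥ 2 and c ≥ 2, so these are part of admissibility.
-- e is a positive integer since r, c, v are positive; e ≥ 1 so e ∸ 1 = e - 1.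
record Admissible (r c v : ℕ) : Set where
  field
    r≥2 : 2 ≤ r
    c≥2 : 2 ≤ c
    v≥1 : 1 ≤ v
    e   : ℕ
    rc≡ev : r * c ≡ e * v
    λrr : ℕ
    λrr-eq : c * (e ∸ 1) ≡ λrr * (r ∸ 1)
    λcc : ℕ
    λcc-eq : r * (e ∸ 1) ≡ λcc * (c ∸ 1)

{-# OPTIONS --safe #-}
-- Writing r = e + 1, the equation rc = ev gives c = et and v = (e + 1)t, where t ≥ 2
-- because v > r.  The integrality of λcc says that d = et − 1 divides e² − 1, so modulo d
-- both et and e² are 1; computing e²t in two ways gives e ≡ t (mod d), and since
-- e, t < d this forces t = e.
module Submission where

open import Defs
open import Data.Nat using (ℕ; _+_; _*_; _<_; _⊔_)
open import Relation.Binary.PropositionalEquality using (_≡_)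
open import Data.Product using (_×_)
open import Data.Nat using (suc; _∸_; _≤_; _%_; NonZero; s≤s; z≤n)
open import Data.Nat.DivMod using (m<n⇒m%n≡m; [m+kn]%n≡m%n)
open import Data.Nat.Divisibility using (_∣_; divides-refl; divides; ∣m⇒∣m*n; n∣m*n)
open import Data.Nat.Properties
open import Data.Nat.Tactic.RingSolver using (solve-∀)
open import Data.Product using (_,_)
open import Relation.Binary.PropositionalEquality
  using (sym; trans; cong; subst; subst₂; module ≡-Reasoning)

congruent-residues-≡ : ∀ {d a b m n} .{{_ : NonZero d}} →
  d ∣ m → d ∣ n → a + m ≡ b + n → a < d → b < d → a ≡ b
congruent-residues-≡ {d} {a} {b} (divides-refl p) (divides-refl q) eq a<d b<d = begin
  a               ≡⟨ m<n⇒m%n≡m a<d ⟨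
  a % d           ≡⟨ [m+kn]%n≡m%n a p d ⟨
  (a + p * d) % d ≡⟨ cong (_% d) eq ⟩
  (b + q * d) % d ≡⟨ [m+kn]%n≡m%n b q d ⟩
  b % d           ≡⟨ m<n⇒m%n≡m b<d ⟩
  b               ∎
  where open ≡-Reasoning

m<m*n∸1 : ∀ {m n} → 2 ≤ m → 2 ≤ n → m < m * n ∸ 1
m<m*n∸1 {m} {n} 2≤m 2≤n = ∸-monoˡ-≤ 1 (begin
  2 + m     ≡⟨ +-comm 2 m ⟩
  m + 2     ≤⟨ +-monoʳ-≤ m 2≤m ⟩
  m + m     ≡⟨ cong (m +_) (*-identityʳ m) ⟨
  m + m * 1 ≡⟨ *-suc m 1 ⟨
  m * 2     ≤⟨ *-monoʳ-≤ m 2≤n ⟩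
  m * n     ∎)
  where open ≤-Reasoning

et∸1∣e*e∸1⇒t≡e : ∀ {e t} → 2 ≤ e → 2 ≤ t → e * t ∸ 1 ∣ e * e ∸ 1 → t ≡ e
et∸1∣e*e∸1⇒t≡e {e} {t} 2≤e@(s≤s (s≤s _)) 2≤t@(s≤s (s≤s _)) d∣q =
  sym (congruent-residues-≡ (n∣m*n e) (∣m⇒∣m*n t d∣q) e+e*d≡t+q*t e<d t<d)
  where
  d : ℕ
  d = e * t ∸ 1
  q : ℕ
  q = e * e ∸ 1
  -- e * t and e * e are literally suc d and suc q, as e, t ≥ 2 are matched as suc (suc _).
  e+e*d≡t+q*t : e + e * d ≡ t + q * t
  e+e*d≡t+q*t = trans (sym (*-suc e d)) (sym (*-assoc e e t))
  e<d : e < d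
  e<d = m<m*n∸1 2≤e 2≤t
  t<d : t < d
  t<d = subst (λ x → t < x ∸ 1) (*-comm t e) (m<m*n∸1 2≤t 2≤e)

[n+1]*[n∸1]≡n*n∸1 : ∀ {n} → 1 ≤ n → (n + 1) * (n ∸ 1) ≡ n * n ∸ 1
[n+1]*[n∸1]≡n*n∸1 {suc n} _ = identity n
  where
  identity : ∀ n → (suc n + 1) * n ≡ n + n * suc n
  identity = solve-∀

[n+1]*m≡n*o⇒m≡n*[o∸m] : ∀ n {m o} → (n + 1) * m ≡ n * o → m ≤ o → m ≡ n * (o ∸ m)
[n+1]*m≡n*o⇒m≡n*[o∸m] n {m} {o} eq m≤o = +-cancelˡ-≡ (n * m) _ _ (begin
  n * m + m           ≡⟨ cong (n * m +_) (*-identityˡ m) ⟨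
  n * m + 1 * m       ≡⟨ *-distribʳ-+ m n 1 ⟨
  (n + 1) * m         ≡⟨ eq ⟩
  n * o               ≡⟨ cong (n *_) (m+[n∸m]≡n m≤o) ⟨
  n * (m + (o ∸ m))   ≡⟨ *-distribˡ-+ n m (o ∸ m) ⟩
  n * m + n * (o ∸ m) ∎)
  where open ≡-Reasoning

lemma2 : (r c v : ℕ) → (A : Admissible r c v) →
    r ⊔ c < v → v < r * c → r ≡ Admissible.e A + 1 →
    (c ≡ Admissible.e A * Admissible.e A) × (v ≡ Admissible.e A * (Admissible.e A + 1))
lemma2 r c v A r⊔c<v v<rc r≡e+1 = c≡e*e , v≡e*[e+1]
  where
  open Admissible A using (e; rc≡ev; λcc; λcc-eq)
  open ≡-Reasoning
  c≤v : c ≤ v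
  c≤v = <⇒≤ (≤-<-trans (m≤n⊔m r c) r⊔c<v)
  t : ℕ
  t = v ∸ c
  c≡e*t : c ≡ e * t
  c≡e*t = [n+1]*m≡n*o⇒m≡n*[o∸m] e (trans (cong (_* c) (sym r≡e+1)) rc≡ev) c≤v
  v≡[e+1]*t : v ≡ (e + 1) * t
  v≡[e+1]*t = begin
    v           ≡⟨ m+[n∸m]≡n c≤v ⟨
    c + t       ≡⟨ cong (_+ t) c≡e*t ⟩
    e * t + t   ≡⟨ +-comm (e * t) t ⟩
    suc e * t   ≡⟨ cong (_* t) (+-comm 1 e) ⟩
    (e + 1) * t ∎
  2≤e : 2 ≤ e
  2≤e = *-cancelʳ-< v 1 e (subst₂ _<_ (sym (*-identityˡ v)) rc≡ev v<rc)
  2≤t : 2 ≤ t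
  2≤t = *-cancelˡ-< (e + 1) 1 t
    (subst₂ _<_ (trans r≡e+1 (sym (*-identityʳ (e + 1)))) v≡[e+1]*t (≤-<-trans (m≤m⊔n r c) r⊔c<v))
  et∸1∣e*e∸1 : e * t ∸ 1 ∣ e * e ∸ 1
  et∸1∣e*e∸1 = subst₂ _∣_ (cong (_∸ 1) c≡e*t)
    (trans (cong (_* (e ∸ 1)) r≡e+1) ([n+1]*[n∸1]≡n*n∸1 (≤-trans (s≤s z≤n) 2≤e)))
    (divides λcc λcc-eq)
  t≡e : t ≡ e
  t≡e = et∸1∣e*e∸1⇒t≡e 2≤e 2≤t et∸1∣e*e∸1
  c≡e*e : c ≡ e * e
  c≡e*e = trans c≡e*t (cong (e *_) t≡e)
  v≡e*[e+1] : v ≡ e * (e + 1)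
  v≡e*[e+1] = trans v≡[e+1]*t (trans (cong ((e + 1) *_) t≡e) (*-comm (e + 1) e))
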